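{- For every $\mathcal{O}\subseteq\{ -,\cup,\cap,+,\times\}$ it holds that $\mathrm{EF}(\mathcal{O})\le_m^{\log}\mathrm{CSP}(\mathcal{O})$.
   Context: Set operations on subsets of $\mathbb{N}=\{0,1,2,\dots\}$: $-A=\mathbb{N}\setminus A$, $\cup$, $\cap$ as usual, $A+B=\{a+b: a\in A,b\in B\}$, $A\times B=\{ab: a\in A,b\in B\}$. An $\mathcal{O}$-circuit is a finite non-empty DAG (multi-edges allowed) with topologically ordered gates and a designated output gate; input gates (indegree $0$) are labelled by natural numbers $c$ (computing $\{c\}$), indegree-$1$ gates are labelled $-$, indegree-$2$ gates are labelled by an operation from $\{\cup,\cap,+,\times\}$, all labels of operations lying in $\mathcal{O}$; each gate computes a set in the obvious way and the circuit computes the set at its output gate. An $\mathcal{O}$-formula is an $\mathcal{O}$-circuit in which every gate has outdegree at most one (i.e. a term). $\mathrm{EF}(\mathcal{O})$ is the set of pairs $(F_1,F_2)$ of $\mathcal{O}$-formulas (with no unassigned inputs) computing the same set. For an $\mathcal{O}$-term built from variables and constants $c\in\mathbb{N}$ (denoting $\{c\}$) using operations in $\mathcal{O}$, $\mathrm{CSP}(\mathcal{O})$ is the problem: given $\exists y_1\dots\exists y_n\bigwedge_{i=1}^m(s_i=t_i)$ with $s_i,t_i$ $\mathcal{O}$-terms, decide whether there exist $a_1,\dots,a_n\in\mathbb{N}$ such that with $y_j$ interpreted as $\{a_j\}$ all equalities hold as equalities of subsets of $\mathbb{N}$. $A\le_m^{\log}B$ means there is a logspace-computable $f$ with $x\in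 A\iff f(x)\in B$ for all $x$. -}

module Defs where

open import Data.Nat using (ℕ; zero; suc; _+_; _*_; _≤_)
open import Data.Nat.Logarithm using (⌊log₂_⌋)
open import Data.Nat.Binary.Base using (ℕᵇ; 2[1+_]; 1+[2_]) renaming (zero to zeroᵇ; fromℕ to toBin)
open import Data.Fin using (Fin)
open import Data.Bool using (Bool; true; false; T)
open import Data.List using (List; []; _∷_; _++_; [_]; length; concatMap)
open import Data.Maybe using (Maybe; just; nothing; _>>=_)
open import Data.Product using (Σ; _×_; _,_; ∃)
open import Data.Sum using (_⊎_)
open import Data.Empty using (⊥)
open import Data.Unit using (⊤)
open import Relation.Nullary using (¬_)
open import Relation.Binary.PropositionalEquality using (_≡_)

SetN : Set₁
SetN = ℕ → Set

data Op : Set where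
  compl union inter plus times : Op

OpSet : Set
OpSet = Op → Bool

data Term (V : Set) : Set where
  const : ℕ → Term V
  var   : V → Term V
  ⊝_    : Term V → Term V
  _∪ₜ_ _∩ₜ_ _+ₜ_ _×ₜ_ : Term V → Term V → Term V

UsesOnly : {V : Set} → OpSet → Term V → Set
UsesOnly O (const c) = ⊤
UsesOnly O (var x) = ⊤
UsesOnly O (⊝ t) = T (O compl) × UsesOnly O t
UsesOnly O (s ∪ₜ t) = T (O union) × UsesOnly O s × UsesOnly O t
UsesOnly O (s ∩ₜ t) = T (O inter) × UsesOnly O s × UsesOnly O t
UsesOnly O (s +ₜ t) = T (O plus) × UsesOnly O s × UsesOnly O t
UsesOnly O (s ×ₜ t) = T (O times) × UsesOnly O s × UsesOnly O t

⟦_⟧ : {V : Set} → Term V → (V → ℕ) → SetN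
⟦ const c ⟧ ρ n = n ≡ c
⟦ var x ⟧ ρ n = n ≡ ρ x
⟦ ⊝ t ⟧ ρ n = ¬ (⟦ t ⟧ ρ n)
⟦ s ∪ₜ t ⟧ ρ n = ⟦ s ⟧ ρ n ⊎ ⟦ t ⟧ ρ n
⟦ s ∩ₜ t ⟧ ρ n = ⟦ s ⟧ ρ n × ⟦ t ⟧ ρ n
⟦ s +ₜ t ⟧ ρ n = Σ ℕ λ a → Σ ℕ λ b → ⟦ s ⟧ ρ a × ⟦ t ⟧ ρ b × n ≡ a + b
⟦ s ×ₜ t ⟧ ρ n = Σ ℕ λ a → Σ ℕ λ b → ⟦ s ⟧ ρ a × ⟦ t ⟧ ρ b × n ≡ a * b

_≐_ : SetN → SetN → Set
A ≐ B = ∀ n → (A n → B n) × (B n → A n)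

Formula : Set
Formula = Term ⊥

noVars : ⊥ → ℕ
noVars ()

-- CSP instance: ∃ y_0 … ∃ y_{n-1} ⋀ (s_i = t_i)
record CSPInstance : Set where
  constructor ∃vars_⋀_
  field
    nvars : ℕ
    eqns  : List (Term (Fin nvars) × Term (Fin nvars))

AllEqs : {V : Set} → (V → ℕ) → List (Term V × Term V) → Set
AllEqs ρ [] = ⊤
AllEqs ρ ((s , t) ∷ es) = (⟦ s ⟧ ρ ≐ ⟦ t ⟧ ρ) × AllEqs ρ es

AllUseOnly : {V : Set} → OpSet → List (Term V × Term V) → Set
AllUseOnly O [] = ⊤
AllUseOnly O ((s , t) ∷ es) = UsesOnly O s × UsesOnly O t × AllUseOnly O es

data Sym : Set where
  #d1 #d2 #end #const #var #comp #union #inter #plus #times #sep #eq : Sym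

Word : Set
Word = List Sym

Language : Set₁
Language = Word → Set

-- natural numbers in bijective base-2 notation (least significant digit first)
encBin : ℕᵇ → Word
encBin zeroᵇ = []
encBin 1+[2 x ] = #d1 ∷ encBin x
encBin 2[1+ x ] = #d2 ∷ encBin x

encℕ : ℕ → Word
encℕ n = encBin (toBin n) ++ [ #end ]

encTerm : {V : Set} → (V → ℕ) → Term V → Word
encTerm ix (const c) = #const ∷ encℕ c
encTerm ix (var x) = #var ∷ encℕ (ix x)
encTerm ix (⊝ t) = #comp ∷ encTerm ix t
encTerm ix (s ∪ₜ t) = #union ∷ encTerm ix s ++ encTerm ix t
encTerm ix (s ∩ₜ t) = #inter ∷ encTerm ix s ++ encTerm ix t
encTerm ix (s +ₜ t) = #plus ∷ encTerm ix s ++ encTerm ix t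
encTerm ix (s ×ₜ t) = #times ∷ encTerm ix s ++ encTerm ix t

encFormula : Formula → Word
encFormula = encTerm noVars

encPair : Formula → Formula → Word
encPair F₁ F₂ = encFormula F₁ ++ #sep ∷ encFormula F₂

encCSP : CSPInstance → Word
encCSP (∃vars n ⋀ es) =
  encℕ n ++ concatMap (λ { (s , t) → #eq ∷ encTerm Data.Fin.toℕ s ++ encTerm Data.Fin.toℕ t }) es

EF : OpSet → Language
EF O w = Σ Formula λ F₁ → Σ Formula λ F₂ →
  UsesOnly O F₁ × UsesOnly O F₂ × w ≡ encPair F₁ F₂ × (⟦ F₁ ⟧ noVars ≐ ⟦ F₂ ⟧ noVars)

CSP : OpSet → Language
CSP O w = Σ CSPInstance λ φ → w ≡ encCSP φ × AllUseOnly O (CSPInstance.eqns φ) ×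
  Σ (Fin (CSPInstance.nvars φ) → ℕ) λ a → AllEqs a (CSPInstance.eqns φ)

-- Logspace transducers: read-only two-way input tape with end markers,
-- one two-way work tape (one-sided infinite), write-only output tape.

data InSym : Set where
  ⊢ ⊣ : InSym
  sym : Sym → InSym

data Move : Set where
  L S R : Move

record TM : Set where
  field
    Q Γ : ℕ
    q₀  : Fin Q
    -- nothing = halt; otherwise (new state, symbol written on work tape,
    -- input head move, work head move, optional output symbol)
    δ   : Fin Q → InSym → Fin (suc Γ) → Maybe (Fin Q × Fin (suc Γ) × Move × Move × Maybe Sym)

module Run (M : TM) (w : Word) where
  open TM M

  record Config : Set where
    field
      state : Fin Q
      ipos  : ℕ            -- 0 = ⊢, 1..|w| = symbols, |w|+1 = ⊣
      tape  : ℕ → Fin (suc Γ)  -- Fin.zero is the blank symbol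
      wpos  : ℕ
      out   : Word

  readIn : ℕ → Word → InSym
  readIn zero _ = ⊢
  readIn (suc i) [] = ⊣
  readIn (suc zero) (a ∷ _) = sym a
  readIn (suc (suc i)) (_ ∷ as) = readIn (suc i) as

  moveL : Move → ℕ → ℕ
  moveL L zero = zero
  moveL L (suc i) = i
  moveL S i = i
  moveL R i = suc i

  moveIn : Move → ℕ → ℕ
  moveIn R i with readIn i w
  ... | ⊣ = i
  ... | _ = suc i
  moveIn m i = moveL m i

  update : (ℕ → Fin (suc Γ)) → ℕ → Fin (suc Γ) → ℕ → Fin (suc Γ)
  update f p g i with Data.Nat._≟_ i p
  ... | Relation.Nullary.yes _ = g
  ... | Relation.Nullary.no _ = f i

  emit : Word → Maybe Sym → Word
  emit o nothing = o
  emit o (just s) = o ++ [ s ]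

  step : Config → Maybe Config
  step c with δ (Config.state c) (readIn (Config.ipos c) w) (Config.tape c (Config.wpos c))
  ... | nothing = nothing
  ... | just (q , g , mi , mw , o) = just record
        { state = q
        ; ipos  = moveIn mi (Config.ipos c)
        ; tape  = update (Config.tape c) (Config.wpos c) g
        ; wpos  = moveL mw (Config.wpos c)
        ; out   = emit (Config.out c) o }

  init : Config
  init = record { state = q₀ ; ipos = 0 ; tape = λ _ → Fin.zero ; wpos = 0 ; out = [] }
    where import Data.Fin as Fin

  steps : ℕ → Maybe Config
  steps zero = just init
  steps (suc i) = steps i >>= step

LogspaceComputes : TM → (Word → Word) → Set
LogspaceComputes M f = Σ ℕ λ k → ∀ w → let open Run M w in
  (Σ ℕ λ t → Σ Config λ c → steps t ≡ just c × step c ≡ nothing × Config.out c ≡ f w)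
  × (∀ i c → steps i ≡ just c → Config.wpos c ≤ k * suc ⌊log₂ (length w) ⌋)

LogspaceComputable : (Word → Word) → Set
LogspaceComputable f = Σ TM λ M → LogspaceComputes M f

_≤ₘˡᵒᵍ_ : Language → Language → Set
A ≤ₘˡᵒᵍ B = Σ (Word → Word) λ f → LogspaceComputable f ×
  (∀ x → (A x → B (f x)) × (B (f x) → A x))

module Submission where

-- Given F₁ #sep F₂, the reduction outputs the variable-free instance F₁ = F₁ ∧ F₁ = F₂, which is
-- satisfiable exactly when F₁ and F₂ denote the same set. A logspace transducer cannot check that its
-- input is well formed, so it blindly emits u = u ∧ u = v for the words u and v before and after the
-- first #sep (turning #eq into #sep, which no instance contains), in three passes over u and one over v,
-- without using its work tape. Conversely, if that word encodes an instance, the equation u = u forces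
-- u to be a term: encodings of terms are Łukasiewicz words (Polish notation with weight arity − 1,
-- #end closing a numeral), which are prefix-free, and u ++ u = x ++ y with x, y Łukasiewicz forces u = x.

open import Defs
open import Data.Bool using (Bool; true; false; T)
open import Data.Empty using (⊥; ⊥-elim)
open import Data.Fin using (Fin; toℕ) renaming (zero to fz; suc to fs)
open import Data.Integer using (ℤ; 0ℤ; 1ℤ; -1ℤ; -[1+_]; _+_; _≤_)
import Data.Integer.Properties as ℤ
open import Data.Integer.Tactic.RingSolver using (solve-∀)
open import Data.List using (List; []; _∷_; _++_; [_]; length; map; concatMap)
open import Data.List.Properties using (∷-injective; ++-identityʳ; ++-assoc; ++-cancelˡ; length-++; length-++-≤ˡ; map-id-local)
open import Data.List.Relation.Unary.All as All using (All; []; _∷_)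
import Data.List.Relation.Unary.All.Properties as All
open import Data.Maybe as Maybe using (Maybe; just; nothing)
open import Data.Nat as ℕ using (ℕ; zero; suc; z≤n; s≤s)
open import Data.Nat.Binary.Base using (2[1+_]; 1+[2_]) renaming (zero to 0ᵇ; fromℕ to toBin; toℕ to fromBin)
open import Data.Nat.Binary.Properties using (toℕ-fromℕ)
open import Data.Nat.Properties using (+-comm; <⇒≤)
open import Data.Product using (∃; ∃₂; _×_; _,_; proj₁; proj₂)
open import Data.Sum using (_⊎_; inj₁; inj₂)
open import Data.Unit using (⊤; tt)
open import Function using (_∘_)
open import Relation.Binary.Construct.Closure.ReflexiveTransitive using (Star; ε; _◅_)
open import Relation.Binary.Construct.Closure.ReflexiveTransitive.Properties using (module StarReasoning)
open import Relation.Binary.PropositionalEquality as ≡ using (_≡_; _≢_; refl; cong; cong₂; subst; subst₂; trans)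
open import Relation.Nullary using (¬_; Dec; yes; no)

module _ {A : Set} where

  ++-split : ∀ (a b c d : List A) → a ++ b ≡ c ++ d →
    (∃ λ r → c ≡ a ++ r × b ≡ r ++ d) ⊎ (∃₂ λ e m → a ≡ c ++ e ∷ m × d ≡ e ∷ m ++ b)
  ++-split []      b c       d eq = inj₁ (c , refl , eq)
  ++-split (x ∷ a) b []      d eq = inj₂ (x , a , refl , ≡.sym eq)
  ++-split (x ∷ a) b (y ∷ c) d eq with ∷-injective eq
  ... | refl , eq′ with ++-split a b c d eq′
  ...   | inj₁ (r , c≡ , b≡)     = inj₁ (r , cong (x ∷_) c≡ , b≡)
  ...   | inj₂ (e , m , a≡ , d≡) = inj₂ (e , m , cong (x ∷_) a≡ , d≡)

  LeadsWith : A → List A → Set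
  LeadsWith z b = b ≡ [] ⊎ ∃ λ b′ → b ≡ z ∷ b′

  ++-cancel-at : ∀ {z : A} {a b c d} → All (_≢ z) a → All (_≢ z) c →
    LeadsWith z b → LeadsWith z d → a ++ b ≡ c ++ d → a ≡ c × b ≡ d
  ++-cancel-at []        []        _                 _                 eq   = refl , eq
  ++-cancel-at []        (y≢z ∷ _) (inj₂ (_ , refl)) _                 refl = ⊥-elim (y≢z refl)
  ++-cancel-at (x≢z ∷ _) []        _                 (inj₂ (_ , refl)) refl = ⊥-elim (x≢z refl)
  ++-cancel-at (_ ∷ pa)  (_ ∷ pc)  lb                ld                eq   with ∷-injective eq
  ... | refl , eq′ with ++-cancel-at pa pc lb ld eq′
  ...   | refl , b≡d = refl , b≡d

  blocks : A → List (List A) → List A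
  blocks z = concatMap (z ∷_)

  blocks-leads : ∀ z xs → LeadsWith z (blocks z xs)
  blocks-leads z []      = inj₁ refl
  blocks-leads z (_ ∷ _) = inj₂ (_ , refl)

  blocks-injective : ∀ {z : A} {xs ys} → All (All (_≢ z)) xs → All (All (_≢ z)) ys →
    blocks z xs ≡ blocks z ys → xs ≡ ys
  blocks-injective []         []         _  = refl
  blocks-injective {z} {_ ∷ xs} {_ ∷ ys} (px ∷ pxs) (py ∷ pys) eq
    with ++-cancel-at px py (blocks-leads z xs) (blocks-leads z ys) (proj₂ (∷-injective eq))
  ... | refl , eq′ = cong (_ ∷_) (blocks-injective pxs pys eq′)

  All-blocks : ∀ {P : A → Set} {z xs} → P z → All (All P) xs → All P (blocks z xs)
  All-blocks pz []         = []
  All-blocks pz (px ∷ pxs) = pz ∷ All.++⁺ px (All-blocks pz pxs)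

Plain : Sym → Set
Plain a = T (isPlain a)
  where
  isPlain : Sym → Bool
  isPlain #sep = false
  isPlain #eq  = false
  isPlain _    = true

plain⇒≢sep : ∀ {a} → Plain a → a ≢ #sep
plain⇒≢sep p refl = p

plain⇒≢eq : ∀ {a} → Plain a → a ≢ #eq
plain⇒≢eq p refl = p

sep-free : ∀ {w} → All Plain w → All (_≢ #sep) w
sep-free = All.map plain⇒≢sep

eq-free : ∀ {w} → All Plain w → All (_≢ #eq) w
eq-free = All.map plain⇒≢eq

not-sep-free : ∀ a b → ¬ All (_≢ #sep) (a ++ #sep ∷ b)
not-sep-free a b ps with All.++⁻ʳ a ps
... | sep≢sep ∷ _ = sep≢sep refl

data Kind : Sym → Set where
  separator : Kind #sep
  equation  : Kind #eq
  plain     : ∀ {a} → Plain a → Kind a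

kind : ∀ a → Kind a
kind #sep   = separator
kind #eq    = equation
kind #d1    = plain tt
kind #d2    = plain tt
kind #end   = plain tt
kind #const = plain tt
kind #var   = plain tt
kind #comp  = plain tt
kind #union = plain tt
kind #inter = plain tt
kind #plus  = plain tt
kind #times = plain tt

sep? : ∀ a → Dec (a ≡ #sep)
sep? a with kind a
... | separator = yes refl
... | equation  = no (λ ())
... | plain p   = no (plain⇒≢sep p)

scrub : Sym → Sym
scrub a with kind a
... | equation = #sep
... | _        = a

scrub-plain : ∀ {a} → Plain a → scrub a ≡ a
scrub-plain {a} p with kind a
... | separator = ⊥-elim p
... | equation  = ⊥-elim p
... | plain _   = refl

scrub-≢eq : ∀ a → scrub a ≢ #eq
scrub-≢eq a with kind a
... | separator = λ ()
... | equation  = λ ()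
... | plain p   = plain⇒≢eq p

scrub-reflects : ∀ a {b} → scrub a ≡ b → b ≢ #sep → a ≡ b
scrub-reflects a with kind a
... | separator = λ eq b≢sep → ⊥-elim (b≢sep (≡.sym eq))
... | equation  = λ eq b≢sep → ⊥-elim (b≢sep (≡.sym eq))
... | plain _   = λ eq _ → eq

map-scrub-plain : ∀ {w} → All Plain w → map scrub w ≡ w
map-scrub-plain ps = map-id-local (All.map scrub-plain ps)

map-scrub-≢eq : ∀ u → All (_≢ #eq) (map scrub u)
map-scrub-≢eq u = All.map⁺ (All.universal scrub-≢eq u)

map-scrub-reflects : ∀ u {w} → map scrub u ≡ w → All (_≢ #sep) w → u ≡ w
map-scrub-reflects []      refl []       = refl
map-scrub-reflects (a ∷ u) refl (p ∷ ps) = cong₂ _∷_ (scrub-reflects a refl p) (map-scrub-reflects u refl ps)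

plain-encBin : ∀ b → All Plain (encBin b)
plain-encBin 0ᵇ       = []
plain-encBin 2[1+ b ] = tt ∷ plain-encBin b
plain-encBin 1+[2 b ] = tt ∷ plain-encBin b

plain-encℕ : ∀ n → All Plain (encℕ n)
plain-encℕ n = All.++⁺ (plain-encBin (toBin n)) (tt ∷ [])

plain-encTerm : ∀ {V} (ix : V → ℕ) t → All Plain (encTerm ix t)
plain-encTerm ix (const c) = tt ∷ plain-encℕ c
plain-encTerm ix (var x)   = tt ∷ plain-encℕ (ix x)
plain-encTerm ix (⊝ t)     = tt ∷ plain-encTerm ix t
plain-encTerm ix (s ∪ₜ t)  = tt ∷ All.++⁺ (plain-encTerm ix s) (plain-encTerm ix t)
plain-encTerm ix (s ∩ₜ t)  = tt ∷ All.++⁺ (plain-encTerm ix s) (plain-encTerm ix t)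
plain-encTerm ix (s +ₜ t)  = tt ∷ All.++⁺ (plain-encTerm ix s) (plain-encTerm ix t)
plain-encTerm ix (s ×ₜ t)  = tt ∷ All.++⁺ (plain-encTerm ix s) (plain-encTerm ix t)

-- Łukasiewicz words

symWeight : Sym → ℤ
symWeight #end   = -1ℤ
symWeight #union = 1ℤ
symWeight #inter = 1ℤ
symWeight #plus  = 1ℤ
symWeight #times = 1ℤ
symWeight _      = 0ℤ

weight : Word → ℤ
weight []      = 0ℤ
weight (a ∷ w) = symWeight a + weight w

weight-++ : ∀ u v → weight (u ++ v) ≡ weight u + weight v
weight-++ []      v = ≡.sym (ℤ.+-identityˡ (weight v))
weight-++ (a ∷ u) v = trans (cong (symWeight a +_) (weight-++ u v)) (≡.sym (ℤ.+-assoc (symWeight a) (weight u) (weight v)))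

record Łukasiewicz (w : Word) : Set where
  field
    total  : weight w ≡ -1ℤ
    prefix : ∀ p a q → w ≡ p ++ a ∷ q → 0ℤ ≤ weight p
open Łukasiewicz

łuk-neutral : ∀ {a w} → symWeight a ≡ 0ℤ → Łukasiewicz w → Łukasiewicz (a ∷ w)
łuk-neutral {a} {w} a≡0 ł = record { total = trans (neutral w) (total ł) ; prefix = prefix′ }
  where
  neutral : ∀ v → weight (a ∷ v) ≡ weight v
  neutral v = trans (cong (_+ weight v) a≡0) (ℤ.+-identityˡ (weight v))
  prefix′ : ∀ p b q → a ∷ w ≡ p ++ b ∷ q → 0ℤ ≤ weight p
  prefix′ []      _ _ _  = ℤ.≤-refl
  prefix′ (_ ∷ p) b q eq with ∷-injective eq
  ... | refl , eq′ = subst (0ℤ ≤_) (≡.sym (neutral p)) (prefix ł p b q eq′)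

łuk-end : ∀ {w} → All (λ a → symWeight a ≡ 0ℤ) w → Łukasiewicz (w ++ [ #end ])
łuk-end []         = record { total = refl ; prefix = λ { [] _ _ _ → ℤ.≤-refl ; (_ ∷ []) _ _ () ; (_ ∷ _ ∷ _) _ _ () } }
łuk-end (a≡0 ∷ ps) = łuk-neutral a≡0 (łuk-end ps)

łuk-node : ∀ {a x y} → symWeight a ≡ 1ℤ → Łukasiewicz x → Łukasiewicz y → Łukasiewicz (a ∷ x ++ y)
łuk-node {a} {x} {y} a≡1 łx ły = record { total = total′ ; prefix = prefix′ }
  where
  1+[-1+z]≡z : ∀ z → 1ℤ + (-1ℤ + z) ≡ z
  1+[-1+z]≡z = solve-∀
  total′ : weight (a ∷ x ++ y) ≡ -1ℤ
  total′ = begin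
    symWeight a + weight (x ++ y) ≡⟨ cong₂ _+_ a≡1 (weight-++ x y) ⟩
    1ℤ + (weight x + weight y)    ≡⟨ cong (λ z → 1ℤ + (z + weight y)) (total łx) ⟩
    1ℤ + (-1ℤ + weight y)         ≡⟨ 1+[-1+z]≡z (weight y) ⟩
    weight y                      ≡⟨ total ły ⟩
    -1ℤ                           ∎
    where open ≡.≡-Reasoning
  prefix′ : ∀ p b q → a ∷ x ++ y ≡ p ++ b ∷ q → 0ℤ ≤ weight p
  prefix′ []      _ _ _  = ℤ.≤-refl
  prefix′ (_ ∷ p) b q eq with ∷-injective eq
  ... | refl , eq′ with ++-split x y p (b ∷ q) eq′
  ...   | inj₁ (r , refl , y≡) = subst (0ℤ ≤_) (≡.sym wp) (prefix ły r b q y≡)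
    where
    wp : weight (a ∷ x ++ r) ≡ weight r
    wp = trans (cong₂ _+_ a≡1 (trans (weight-++ x r) (cong (_+ weight r) (total łx)))) (1+[-1+z]≡z (weight r))
  ...   | inj₂ (e , m , x≡ , _) =
    subst (0ℤ ≤_) (cong (_+ weight p) (≡.sym a≡1)) (ℤ.≤-trans (prefix łx p e m x≡) (ℤ.i≤j⇒i≤1+j ℤ.≤-refl))

łuk-encℕ : ∀ n → Łukasiewicz (encℕ n)
łuk-encℕ n = łuk-end (neutral-encBin (toBin n))
  where
  neutral-encBin : ∀ b → All (λ a → symWeight a ≡ 0ℤ) (encBin b)
  neutral-encBin 0ᵇ       = []
  neutral-encBin 2[1+ b ] = refl ∷ neutral-encBin b
  neutral-encBin 1+[2 b ] = refl ∷ neutral-encBin b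

łuk-encTerm : ∀ {V} (ix : V → ℕ) t → Łukasiewicz (encTerm ix t)
łuk-encTerm ix (const c) = łuk-neutral refl (łuk-encℕ c)
łuk-encTerm ix (var x)   = łuk-neutral refl (łuk-encℕ (ix x))
łuk-encTerm ix (⊝ t)     = łuk-neutral refl (łuk-encTerm ix t)
łuk-encTerm ix (s ∪ₜ t)  = łuk-node refl (łuk-encTerm ix s) (łuk-encTerm ix t)
łuk-encTerm ix (s ∩ₜ t)  = łuk-node refl (łuk-encTerm ix s) (łuk-encTerm ix t)
łuk-encTerm ix (s +ₜ t)  = łuk-node refl (łuk-encTerm ix s) (łuk-encTerm ix t)
łuk-encTerm ix (s ×ₜ t)  = łuk-node refl (łuk-encTerm ix s) (łuk-encTerm ix t)

łuk-not-proper-prefix : ∀ {x y e r} → Łukasiewicz x → Łukasiewicz y → y ≢ x ++ e ∷ r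
łuk-not-proper-prefix {x} {e = e} {r} łx ły eq with subst (0ℤ ≤_) (total łx) (prefix ły x e r eq)
... | ()

łuk-prefix-free : ∀ {x y a b} → Łukasiewicz x → Łukasiewicz y → x ++ a ≡ y ++ b → x ≡ y × a ≡ b
łuk-prefix-free {x} {y} {a} {b} łx ły eq with ++-split x a y b eq
... | inj₁ ([] , y≡ , a≡)    = ≡.sym (trans y≡ (++-identityʳ x)) , a≡
... | inj₁ (_ ∷ _ , y≡ , _) = ⊥-elim (łuk-not-proper-prefix łx ły y≡)
... | inj₂ (_ , _ , x≡ , _) = ⊥-elim (łuk-not-proper-prefix ły łx x≡)

0≤z⇒z+z≢-2 : ∀ {z} → 0ℤ ≤ z → z + z ≢ -[1+ 1 ]
0≤z⇒z+z≢-2 0≤z eq with subst (0ℤ ≤_) eq (ℤ.+-mono-≤ 0≤z 0≤z)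
... | ()

-- Counting weights gives weight u = -1, although u is a proper prefix of x.
łuk-square-shorter : ∀ {u x y e r} → Łukasiewicz x → Łukasiewicz y → x ≡ u ++ e ∷ r → u ≡ (e ∷ r) ++ y → ⊥
łuk-square-shorter {u} {x} {y} {e} {r} łx ły x≡ u≡ = 0≤z⇒z+z≢-2 (prefix łx u e r x≡) 2Wu≡-2
  where
  open ≡.≡-Reasoning
  Wu = weight u
  Wr = weight (e ∷ r)
  Wu≡Wr-1 : Wu ≡ Wr + -1ℤ
  Wu≡Wr-1 = trans (cong weight u≡) (trans (weight-++ (e ∷ r) y) (cong (Wr +_) (total ły)))
  Wu+Wr≡-1 : Wu + Wr ≡ -1ℤ
  Wu+Wr≡-1 = trans (≡.sym (weight-++ u (e ∷ r))) (trans (cong weight (≡.sym x≡)) (total łx))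
  2Wu≡-2 : Wu + Wu ≡ -[1+ 1 ]
  2Wu≡-2 = begin
    Wu + Wu          ≡⟨ cong (Wu +_) Wu≡Wr-1 ⟩
    Wu + (Wr + -1ℤ)  ≡⟨ ℤ.+-assoc Wu Wr -1ℤ ⟨
    (Wu + Wr) + -1ℤ  ≡⟨ cong (_+ -1ℤ) Wu+Wr≡-1 ⟩
    -[1+ 1 ]         ∎

-- Counting weights gives weight (e ∷ m) = 0, although (e ∷ m) ++ x is a proper prefix of y.
łuk-square-longer : ∀ {u x y e m} → Łukasiewicz x → Łukasiewicz y → u ≡ x ++ e ∷ m → y ≡ (e ∷ m) ++ u → ⊥
łuk-square-longer {u} {x} {y} {e} {m} łx ły u≡ y≡ = 0≤z⇒z+z≢-2 0≤Wm-1 2[Wm-1]≡-2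
  where
  open ≡.≡-Reasoning
  Wm = weight (e ∷ m)
  y≡′ : y ≡ ((e ∷ m) ++ x) ++ e ∷ m
  y≡′ = trans y≡ (trans (cong ((e ∷ m) ++_) u≡) (≡.sym (++-assoc (e ∷ m) x (e ∷ m))))
  0≤Wm-1 : 0ℤ ≤ Wm + -1ℤ
  0≤Wm-1 = subst (0ℤ ≤_) (trans (weight-++ (e ∷ m) x) (cong (Wm +_) (total łx))) (prefix ły ((e ∷ m) ++ x) e m y≡′)
  Wu≡-1+Wm : weight u ≡ -1ℤ + Wm
  Wu≡-1+Wm = trans (cong weight u≡) (trans (weight-++ x (e ∷ m)) (cong (_+ Wm) (total łx)))
  Wm+Wu≡-1 : Wm + weight u ≡ -1ℤ
  Wm+Wu≡-1 = trans (≡.sym (weight-++ (e ∷ m) u)) (trans (cong weight (≡.sym y≡)) (total ły))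
  regroup : ∀ z → (z + -1ℤ) + (z + -1ℤ) ≡ (z + (-1ℤ + z)) + -1ℤ
  regroup = solve-∀
  2[Wm-1]≡-2 : (Wm + -1ℤ) + (Wm + -1ℤ) ≡ -[1+ 1 ]
  2[Wm-1]≡-2 = begin
    (Wm + -1ℤ) + (Wm + -1ℤ)  ≡⟨ regroup Wm ⟩
    (Wm + (-1ℤ + Wm)) + -1ℤ  ≡⟨ cong (λ z → (Wm + z) + -1ℤ) Wu≡-1+Wm ⟨
    (Wm + weight u) + -1ℤ    ≡⟨ cong (_+ -1ℤ) Wm+Wu≡-1 ⟩
    -[1+ 1 ]                 ∎

łuk-square : ∀ {u x y} → Łukasiewicz x → Łukasiewicz y → u ++ u ≡ x ++ y → u ≡ x
łuk-square {u} {x} {y} łx ły eq with ++-split u u x y eq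
... | inj₁ ([] , x≡ , _)      = ≡.sym (trans x≡ (++-identityʳ u))
... | inj₁ (_ ∷ _ , x≡ , u≡)  = ⊥-elim (łuk-square-shorter łx ły x≡ u≡)
... | inj₂ (_ , _ , u≡ , y≡)  = ⊥-elim (łuk-square-longer łx ły u≡ y≡)

rename : ∀ {V W : Set} → (V → W) → Term V → Term W
rename h (const c) = const c
rename h (var x)   = var (h x)
rename h (⊝ t)     = ⊝ rename h t
rename h (s ∪ₜ t)  = rename h s ∪ₜ rename h t
rename h (s ∩ₜ t)  = rename h s ∩ₜ rename h t
rename h (s +ₜ t)  = rename h s +ₜ rename h t
rename h (s ×ₜ t)  = rename h s ×ₜ rename h t

module _ {V W : Set} (h : V → W) where

  encTerm-rename : ∀ {ixW ixV} → (∀ x → ixW (h x) ≡ ixV x) → ∀ t → encTerm ixW (rename h t) ≡ encTerm ixV t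
  encTerm-rename p (const c) = refl
  encTerm-rename p (var x)   = cong (λ n → #var ∷ encℕ n) (p x)
  encTerm-rename p (⊝ t)     = cong (#comp ∷_) (encTerm-rename p t)
  encTerm-rename p (s ∪ₜ t)  = cong (#union ∷_) (cong₂ _++_ (encTerm-rename p s) (encTerm-rename p t))
  encTerm-rename p (s ∩ₜ t)  = cong (#inter ∷_) (cong₂ _++_ (encTerm-rename p s) (encTerm-rename p t))
  encTerm-rename p (s +ₜ t)  = cong (#plus ∷_) (cong₂ _++_ (encTerm-rename p s) (encTerm-rename p t))
  encTerm-rename p (s ×ₜ t)  = cong (#times ∷_) (cong₂ _++_ (encTerm-rename p s) (encTerm-rename p t))

  usesOnly-rename : ∀ O t → UsesOnly O t → UsesOnly O (rename h t)
  usesOnly-rename O (const c) u           = tt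
  usesOnly-rename O (var x)   u           = tt
  usesOnly-rename O (⊝ t)     (o , u)     = o , usesOnly-rename O t u
  usesOnly-rename O (s ∪ₜ t)  (o , u , v) = o , usesOnly-rename O s u , usesOnly-rename O t v
  usesOnly-rename O (s ∩ₜ t)  (o , u , v) = o , usesOnly-rename O s u , usesOnly-rename O t v
  usesOnly-rename O (s +ₜ t)  (o , u , v) = o , usesOnly-rename O s u , usesOnly-rename O t v
  usesOnly-rename O (s ×ₜ t)  (o , u , v) = o , usesOnly-rename O s u , usesOnly-rename O t v

  ⟦⟧-rename : ∀ {ρ ρ′} → (∀ x → ρ (h x) ≡ ρ′ x) → ∀ t → ⟦ rename h t ⟧ ρ ≡ ⟦ t ⟧ ρ′
  ⟦⟧-rename p (const c) = refl
  ⟦⟧-rename p (var x)   = cong (λ m n → n ≡ m) (p x)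
  ⟦⟧-rename p (⊝ t)     = cong (λ A n → ¬ A n) (⟦⟧-rename p t)
  ⟦⟧-rename p (s ∪ₜ t)  = cong₂ (λ A B n → A n ⊎ B n) (⟦⟧-rename p s) (⟦⟧-rename p t)
  ⟦⟧-rename p (s ∩ₜ t)  = cong₂ (λ A B n → A n × B n) (⟦⟧-rename p s) (⟦⟧-rename p t)
  ⟦⟧-rename p (s +ₜ t)  =
    cong₂ (λ A B n → ∃₂ λ a b → A a × B b × n ≡ a ℕ.+ b) (⟦⟧-rename p s) (⟦⟧-rename p t)
  ⟦⟧-rename p (s ×ₜ t)  =
    cong₂ (λ A B n → ∃₂ λ a b → A a × B b × n ≡ a ℕ.* b) (⟦⟧-rename p s) (⟦⟧-rename p t)

≐-refl : ∀ {A} → A ≐ A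
≐-refl n = (λ a → a) , (λ a → a)

toCSPTerm : Formula → Term (Fin 0)
toCSPTerm = rename λ ()

toFormula : Term (Fin 0) → Formula
toFormula = rename λ ()

encEquation : ∀ {n} → Term (Fin n) × Term (Fin n) → Word
encEquation (s , t) = encTerm toℕ s ++ encTerm toℕ t

plain-encEquation : ∀ {n} (e : Term (Fin n) × Term (Fin n)) → All Plain (encEquation e)
plain-encEquation (s , t) = All.++⁺ (plain-encTerm toℕ s) (plain-encTerm toℕ t)

encCSP-blocks : ∀ n es → encCSP (∃vars n ⋀ es) ≡ encℕ n ++ blocks #eq (map encEquation es)
encCSP-blocks n []             = refl
encCSP-blocks n ((s , t) ∷ es) =
  cong (λ w → encℕ n ++ (#eq ∷ encEquation (s , t) ++ w)) (++-cancelˡ (encℕ n) _ _ (encCSP-blocks n es))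

encCSP-sep-free : ∀ φ → All (_≢ #sep) (encCSP φ)
encCSP-sep-free (∃vars n ⋀ es) = subst (All (_≢ #sep)) (≡.sym (encCSP-blocks n es))
  (All.++⁺ (sep-free (plain-encℕ n)) (All-blocks (λ ()) (All.map⁺ (All.universal (sep-free ∘ plain-encEquation) es))))

encℕ-leading-#end : ∀ n {r r′} → encℕ n ++ r ≡ #end ∷ r′ → n ≡ 0 × r ≡ r′
encℕ-leading-#end n eq with toBin n in n≡
... | 0ᵇ = trans (≡.sym (toℕ-fromℕ n)) (cong fromBin n≡) , proj₂ (∷-injective eq)

-- The reduction

data SepSplit (x : Word) : Set where
  no-sep : All (_≢ #sep) x → SepSplit x
  at-sep : ∀ u v → All (_≢ #sep) u → x ≡ u ++ #sep ∷ v → SepSplit x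

sepSplit : ∀ x → SepSplit x
sepSplit []      = no-sep []
sepSplit (a ∷ x) with sep? a
... | yes refl = at-sep [] x [] refl
... | no a≢sep with sepSplit x
...   | no-sep ps          = no-sep (a≢sep ∷ ps)
...   | at-sep u v pu refl = at-sep (a ∷ u) v (a≢sep ∷ pu) refl

cspWord : Word → Word → Word
cspWord u v = encℕ 0 ++ blocks #eq ((u ++ u) ∷ (u ++ v) ∷ [])

-- Without a separator the output contains #sep, so it encodes no instance.
reduce : Word → Word
reduce x with sepSplit x
... | no-sep _       = #end ∷ #eq ∷ map scrub x ++ [ #sep ]
... | at-sep u v _ _ = cspWord (map scrub u) (map scrub v)

module _ (O : OpSet) where

  ef⇒csp : ∀ x → EF O x → CSP O (reduce x)
  ef⇒csp x (F₁ , F₂ , u₁ , u₂ , refl , F₁≐F₂) with sepSplit (encPair F₁ F₂)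
  ... | no-sep ps = ⊥-elim (not-sep-free (encFormula F₁) (encFormula F₂) ps)
  ... | at-sep u v pu eq
    with ++-cancel-at pu (sep-free (plain-encTerm noVars F₁)) (inj₂ (_ , refl)) (inj₂ (_ , refl)) (≡.sym eq)
  ...   | refl , refl = φ , encoding , uses , (λ ()) , ≐-refl , sem , tt
    where
    φ : CSPInstance
    φ = ∃vars 0 ⋀ ((toCSPTerm F₁ , toCSPTerm F₁) ∷ (toCSPTerm F₁ , toCSPTerm F₂) ∷ [])
    scrub-encFormula : ∀ F → map scrub (encFormula F) ≡ encTerm toℕ (toCSPTerm F)
    scrub-encFormula F = trans (map-scrub-plain (plain-encTerm noVars F)) (≡.sym (encTerm-rename _ (λ ()) F))
    encoding : cspWord (map scrub (encFormula F₁)) (map scrub (encFormula F₂)) ≡ encCSP φ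
    encoding = trans (cong₂ cspWord (scrub-encFormula F₁) (scrub-encFormula F₂))
                     (≡.sym (encCSP-blocks 0 (CSPInstance.eqns φ)))
    uses : AllUseOnly O (CSPInstance.eqns φ)
    uses = u₁′ , u₁′ , u₁′ , usesOnly-rename _ O F₂ u₂ , tt
      where u₁′ = usesOnly-rename _ O F₁ u₁
    sem : ⟦ toCSPTerm F₁ ⟧ (λ ()) ≐ ⟦ toCSPTerm F₂ ⟧ (λ ())
    sem = subst₂ _≐_ (≡.sym (⟦⟧-rename _ (λ ()) F₁)) (≡.sym (⟦⟧-rename _ (λ ()) F₂)) F₁≐F₂

  -- F₁ is read off the second equation, so encTerm s₂ ≡ encTerm s₁ suffices (no injectivity of encTerm).
  satisfiable⇒ef : ∀ u v (es : List (Term (Fin 0) × Term (Fin 0))) →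
    map encEquation es ≡ (map scrub u ++ map scrub u) ∷ (map scrub u ++ map scrub v) ∷ [] →
    AllUseOnly O es → (a : Fin 0 → ℕ) → AllEqs a es → EF O (u ++ #sep ∷ v)
  satisfiable⇒ef u v []              () _ _ _
  satisfiable⇒ef u v (_ ∷ [])        () _ _ _
  satisfiable⇒ef u v (_ ∷ _ ∷ _ ∷ _) () _ _ _
  satisfiable⇒ef u v ((s₁ , t₁) ∷ (s₂ , t₂) ∷ []) eq (_ , _ , us₂ , ut₂ , _) a (_ , s₂≐t₂ , _)
    with ∷-injective eq
  ... | eq₁ , eq₂′ with ∷-injective eq₂′
  ...   | eq₂ , _ = toFormula s₂ , toFormula t₂ , usesOnly-rename _ O s₂ us₂ , usesOnly-rename _ O t₂ ut₂ , word , sem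
    where
    E : Term (Fin 0) → Word
    E = encTerm toℕ
    su≡Es₁ : map scrub u ≡ E s₁
    su≡Es₁ = łuk-square (łuk-encTerm toℕ s₁) (łuk-encTerm toℕ t₁) (≡.sym eq₁)
    Es₂≡Es₁×Et₂≡sv : E s₂ ≡ E s₁ × E t₂ ≡ map scrub v
    Es₂≡Es₁×Et₂≡sv =
      łuk-prefix-free (łuk-encTerm toℕ s₂) (łuk-encTerm toℕ s₁) (trans eq₂ (cong (_++ map scrub v) su≡Es₁))
    decode : ∀ w t → map scrub w ≡ E t → w ≡ encFormula (toFormula t)
    decode w t sw≡ = trans (map-scrub-reflects w sw≡ (sep-free (plain-encTerm toℕ t))) (≡.sym (encTerm-rename _ (λ ()) t))
    word : u ++ #sep ∷ v ≡ encPair (toFormula s₂) (toFormula t₂)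
    word = cong₂ (λ p q → p ++ #sep ∷ q)
      (decode u s₂ (trans su≡Es₁ (≡.sym (proj₁ Es₂≡Es₁×Et₂≡sv))))
      (decode v t₂ (≡.sym (proj₂ Es₂≡Es₁×Et₂≡sv)))
    sem : ⟦ toFormula s₂ ⟧ noVars ≐ ⟦ toFormula t₂ ⟧ noVars
    sem = subst₂ _≐_ (≡.sym (⟦⟧-rename _ (λ ()) s₂)) (≡.sym (⟦⟧-rename _ (λ ()) t₂)) s₂≐t₂

  csp⇒ef : ∀ x → CSP O (reduce x) → EF O x
  csp⇒ef x (φ@(∃vars n ⋀ es) , eq , uses , a , sat) with sepSplit x
  ... | no-sep _ =
    ⊥-elim (not-sep-free (#end ∷ #eq ∷ map scrub x) [] (subst (All (_≢ #sep)) (≡.sym eq) (encCSP-sep-free φ)))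
  ... | at-sep u v _ refl with encℕ-leading-#end n (trans (≡.sym (encCSP-blocks n es)) (≡.sym eq))
  ...   | refl , blocks≡ = satisfiable⇒ef u v es (blocks-injective eq-free-lhs eq-free-rhs blocks≡) uses a sat
    where
    eq-free-lhs : All (All (_≢ #eq)) (map encEquation es)
    eq-free-lhs = All.map⁺ (All.universal (eq-free ∘ plain-encEquation) es)
    eq-free-rhs : All (All (_≢ #eq)) ((map scrub u ++ map scrub u) ∷ (map scrub u ++ map scrub v) ∷ [])
    eq-free-rhs = All.++⁺ (map-scrub-≢eq u) (map-scrub-≢eq u) ∷ All.++⁺ (map-scrub-≢eq u) (map-scrub-≢eq v) ∷ []

-- The transducer

State : Set
State = Fin 9

pattern emitEnd  = fz
pattern emitEq   = fs fz
pattern copy₁    = fs (fs fz)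
pattern back₁    = fs (fs (fs fz))
pattern copy₂    = fs (fs (fs (fs fz)))
pattern back₂    = fs (fs (fs (fs (fs fz))))
pattern copy₃    = fs (fs (fs (fs (fs (fs fz)))))
pattern copyRest = fs (fs (fs (fs (fs (fs (fs fz))))))
pattern halt     = fs (fs (fs (fs (fs (fs (fs (fs fz)))))))

Action : Set
Action = State × Move × Maybe Sym

copying : State → Sym → Maybe Action
copying q a = just (q , R , just (scrub a))

copyUntilSep : State → Sym → Action → Maybe Action
copyUntilSep q a atSep with sep? a
... | yes _ = just atSep
... | no _  = copying q a

copyUntilSep-≢ : ∀ q {a} atSep → a ≢ #sep → copyUntilSep q a atSep ≡ copying q a
copyUntilSep-≢ q {a} atSep a≢sep with sep? a
... | yes a≡sep = ⊥-elim (a≢sep a≡sep)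
... | no _      = refl

table : State → InSym → Maybe Action
table emitEnd  _       = just (emitEq , S , just #end)
table emitEq   _       = just (copy₁ , R , just #eq)
table copy₁    (sym a) = copyUntilSep copy₁ a (back₁ , L , nothing)
table copy₁    ⊣       = just (halt , S , just #sep)
table back₁    (sym _) = just (back₁ , L , nothing)
table back₁    ⊢       = just (copy₂ , R , nothing)
table copy₂    (sym a) = copyUntilSep copy₂ a (back₂ , L , just #eq)
table back₂    (sym _) = just (back₂ , L , nothing)
table back₂    ⊢       = just (copy₃ , R , nothing)
table copy₃    (sym a) = copyUntilSep copy₃ a (copyRest , R , nothing)
table copyRest (sym a) = copying copyRest a
table _        _       = nothing

reducer : TM
reducer = record { Q = 9 ; Γ = 0 ; q₀ = emitEnd ; δ = λ q i _ → Maybe.map onTapes (table q i) }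
  where
  onTapes : Action → State × Fin 1 × Move × Move × Maybe Sym
  onTapes (q , m , o) = q , fz , m , S , o

-- The input position of the symbol following pre (position 0 holds ⊢).
pos : Word → ℕ
pos pre = suc (length pre)

pos-∷ʳ : ∀ pre a → pos (pre ++ [ a ]) ≡ suc (pos pre)
pos-∷ʳ pre a = cong suc (trans (length-++ pre) (+-comm (length pre) 1))

module Execution (w : Word) where
  open Run reducer w public

  Snapshot : Set
  Snapshot = State × ℕ × Word

  snapshot : Config → Snapshot
  snapshot c = Config.state c , Config.ipos c , Config.out c

  data _⟶_ : Snapshot → Snapshot → Set where
    move : ∀ {q i o q′ m e} → table q (readIn i w) ≡ just (q′ , m , e) → (q , i , o) ⟶ (q′ , moveIn m i , emit o e)

  _⟶*_ : Snapshot → Snapshot → Set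
  _⟶*_ = Star _⟶_

  step-simulates : ∀ c {σ} → snapshot c ⟶ σ → ∃ λ c′ → step c ≡ just c′ × snapshot c′ ≡ σ
  step-simulates c (move t≡) rewrite t≡ = _ , refl , refl

  steps-simulate : ∀ t c {σ} → steps t ≡ just c → snapshot c ⟶* σ →
    ∃₂ λ t′ c′ → steps t′ ≡ just c′ × snapshot c′ ≡ σ
  steps-simulate t c s≡ ε        = t , c , s≡ , refl
  steps-simulate t c s≡ (x ◅ xs) with step-simulates c x
  ... | c′ , st≡ , refl = steps-simulate (suc t) c′ (trans (cong (Maybe._>>= step) s≡) st≡) xs

  step-halts : ∀ c → table (Config.state c) (readIn (Config.ipos c) w) ≡ nothing → step c ≡ nothing
  step-halts c t≡ rewrite t≡ = refl

  step-keeps-wpos : ∀ c {c′} → step c ≡ just c′ → Config.wpos c′ ≡ Config.wpos c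
  step-keeps-wpos c st≡ with table (Config.state c) (readIn (Config.ipos c) w)
  step-keeps-wpos c refl | just _ = refl

  wpos≡0 : ∀ t {c} → steps t ≡ just c → Config.wpos c ≡ 0
  wpos≡0 zero    refl = refl
  wpos≡0 (suc t) s≡ with steps t in st≡
  ... | just c = trans (step-keeps-wpos c s≡) (wpos≡0 t st≡)

  HaltsWith : Word → Set
  HaltsWith o = ∃₂ λ t c → steps t ≡ just c × step c ≡ nothing × Config.out c ≡ o

  halts-with : ∀ {q i o} → (emitEnd , 0 , []) ⟶* (q , i , o) → table q (readIn i w) ≡ nothing → HaltsWith o
  halts-with run stuck with steps-simulate 0 init refl run
  ... | t , c , s≡ , refl = t , c , s≡ , step-halts c stuck , refl

  read-at : ∀ pre a r → readIn (pos pre) (pre ++ a ∷ r) ≡ sym a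
  read-at []        a r = refl
  read-at (_ ∷ pre) a r = read-at pre a r

  read-end : ∀ v → readIn (pos v) v ≡ ⊣
  read-end []      = refl
  read-end (_ ∷ v) = read-end v

  moveIn-R : ∀ {i a} → readIn i w ≡ sym a → moveIn R i ≡ suc i
  moveIn-R {i} r≡ with readIn i w
  moveIn-R refl | _ = refl

  copy : ∀ q (P : Sym → Set) → (∀ {a} → P a → table q (sym a) ≡ copying q a) →
    ∀ pre seg rest o → w ≡ pre ++ seg ++ rest → All P seg →
    (q , pos pre , o) ⟶* (q , pos (pre ++ seg) , o ++ map scrub seg)
  copy q P copies pre [] rest o _ [] =
    subst₂ (λ i o′ → (q , pos pre , o) ⟶* (q , i , o′)) (cong pos (≡.sym (++-identityʳ pre))) (≡.sym (++-identityʳ o)) ε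
  copy q P copies pre (a ∷ seg) rest o w≡ (pa ∷ ps) = begin
    (q , pos pre , o)
      ⟶⟨ move (trans (cong (table q) reads-a) (copies pa)) ⟩
    (q , moveIn R (pos pre) , o ++ [ scrub a ])
      ≡⟨ cong (λ i → q , i , o ++ [ scrub a ]) (trans (moveIn-R reads-a) (≡.sym (pos-∷ʳ pre a))) ⟩
    (q , pos (pre ++ [ a ]) , o ++ [ scrub a ])
      ⟶*⟨ copy q P copies (pre ++ [ a ]) seg rest _ (trans w≡ (≡.sym (++-assoc pre [ a ] (seg ++ rest)))) ps ⟩
    (q , pos ((pre ++ [ a ]) ++ seg) , (o ++ [ scrub a ]) ++ map scrub seg)
      ≡⟨ cong₂ (λ i o′ → q , i , o′) (cong pos (++-assoc pre [ a ] seg)) (++-assoc o [ scrub a ] (map scrub seg)) ⟩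
    (q , pos (pre ++ a ∷ seg) , o ++ map scrub (a ∷ seg))
      ∎
    where
    open StarReasoning _⟶_
    reads-a : readIn (pos pre) w ≡ sym a
    reads-a = trans (cong (readIn (pos pre)) w≡) (read-at pre a (seg ++ rest))

  read-inside : ∀ i v → suc i ℕ.≤ length v → ∃ λ a → readIn (suc i) v ≡ sym a
  read-inside zero    (a ∷ _) _         = a , refl
  read-inside (suc i) (_ ∷ v) (s≤s i<v) = read-inside i v i<v

  rewind : ∀ q q′ → (∀ a → table q (sym a) ≡ just (q , L , nothing)) → table q ⊢ ≡ just (q′ , R , nothing) →
    ∀ i o → i ℕ.≤ length w → (q , i , o) ⟶* (q′ , 1 , o)
  rewind q q′ left atStart zero    o _   = move atStart ◅ ε
  rewind q q′ left atStart (suc i) o i<w with read-inside i w i<w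
  ... | a , reads-a = move (trans (cong (table q) reads-a) (left a)) ◅ rewind q q′ left atStart i o (<⇒≤ i<w)

run-no-sep : ∀ w → All (_≢ #sep) w → Execution.HaltsWith w (#end ∷ #eq ∷ map scrub w ++ [ #sep ])
run-no-sep w ps = halts-with run refl
  where
  open Execution w
  open StarReasoning _⟶_
  run : (emitEnd , 0 , []) ⟶* (halt , pos w , #end ∷ #eq ∷ map scrub w ++ [ #sep ])
  run = begin
    (emitEnd , 0 , [])                                    ⟶⟨ move refl ⟩
    (emitEq , 0 , [ #end ])                               ⟶⟨ move refl ⟩
    (copy₁ , 1 , #end ∷ #eq ∷ [])
      ⟶*⟨ copy copy₁ (_≢ #sep) (copyUntilSep-≢ copy₁ _) [] w [] _ (≡.sym (++-identityʳ w)) ps ⟩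
    (copy₁ , pos w , #end ∷ #eq ∷ map scrub w)            ⟶⟨ move (cong (table copy₁) (read-end w)) ⟩
    (halt , pos w , #end ∷ #eq ∷ map scrub w ++ [ #sep ]) ∎

run-at-sep : ∀ u v → All (_≢ #sep) u → Execution.HaltsWith (u ++ #sep ∷ v) (cspWord (map scrub u) (map scrub v))
run-at-sep u v pu = halts-with run (cong (table copyRest) (read-end w))
  where
  w = u ++ #sep ∷ v
  su = map scrub u
  sv = map scrub v
  open Execution w
  open StarReasoning _⟶_
  o₀ = #end ∷ #eq ∷ []
  o₂ = ((o₀ ++ su) ++ su) ++ [ #eq ]
  |u|≤|w| : length u ℕ.≤ length w
  |u|≤|w| = length-++-≤ˡ u
  reads-sep : readIn (pos u) w ≡ sym #sep
  reads-sep = read-at u #sep v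
  copies : ∀ q → (∀ {a} → a ≢ #sep → table q (sym a) ≡ copying q a) → ∀ o →
    (q , 1 , o) ⟶* (q , pos u , o ++ su)
  copies q table≡ o = copy q (_≢ #sep) table≡ [] u (#sep ∷ v) o refl pu
  run : (emitEnd , 0 , []) ⟶* (copyRest , pos w , cspWord su sv)
  run = begin
    (emitEnd , 0 , [])                     ⟶⟨ move refl ⟩
    (emitEq , 0 , [ #end ])                ⟶⟨ move refl ⟩
    (copy₁ , 1 , o₀)                       ⟶*⟨ copies copy₁ (copyUntilSep-≢ copy₁ _) o₀ ⟩
    (copy₁ , pos u , o₀ ++ su)             ⟶⟨ move (cong (table copy₁) reads-sep) ⟩
    (back₁ , length u , o₀ ++ su)          ⟶*⟨ rewind back₁ copy₂ (λ _ → refl) refl (length u) _ |u|≤|w| ⟩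
    (copy₂ , 1 , o₀ ++ su)                 ⟶*⟨ copies copy₂ (copyUntilSep-≢ copy₂ _) (o₀ ++ su) ⟩
    (copy₂ , pos u , (o₀ ++ su) ++ su)     ⟶⟨ move (cong (table copy₂) reads-sep) ⟩
    (back₂ , length u , o₂)                ⟶*⟨ rewind back₂ copy₃ (λ _ → refl) refl (length u) _ |u|≤|w| ⟩
    (copy₃ , 1 , o₂)                       ⟶*⟨ copies copy₃ (copyUntilSep-≢ copy₃ _) o₂ ⟩
    (copy₃ , pos u , o₂ ++ su)             ⟶⟨ move (cong (table copy₃) reads-sep) ⟩
    (copyRest , moveIn R (pos u) , o₂ ++ su)
      ≡⟨ cong (λ i → copyRest , i , o₂ ++ su) (trans (moveIn-R reads-sep) (≡.sym (pos-∷ʳ u #sep))) ⟩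
    (copyRest , pos (u ++ [ #sep ]) , o₂ ++ su)
      ⟶*⟨ copy copyRest (λ _ → ⊤) (λ _ → refl) (u ++ [ #sep ]) v [] (o₂ ++ su) w≡ (All.universal (λ _ → tt) v) ⟩
    (copyRest , pos ((u ++ [ #sep ]) ++ v) , (o₂ ++ su) ++ sv)
      ≡⟨ cong₂ (λ i o → copyRest , i , o) (cong pos (++-assoc u [ #sep ] v)) (cong (λ z → #end ∷ #eq ∷ z) (regroup (su ++ su))) ⟩
    (copyRest , pos w , cspWord su sv)     ∎
    where
    w≡ : w ≡ (u ++ [ #sep ]) ++ v ++ []
    w≡ = ≡.sym (trans (cong ((u ++ [ #sep ]) ++_) (++-identityʳ v)) (++-assoc u [ #sep ] v))
    regroup : ∀ x → ((x ++ [ #eq ]) ++ su) ++ sv ≡ x ++ #eq ∷ (su ++ sv) ++ []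
    regroup x = trans (++-assoc (x ++ [ #eq ]) su sv)
      (trans (++-assoc x [ #eq ] (su ++ sv)) (cong (λ z → x ++ #eq ∷ z) (≡.sym (++-identityʳ (su ++ sv)))))

reducer-computes : LogspaceComputes reducer reduce
reducer-computes = 0 , λ w → runs w , λ t c s≡ → subst (ℕ._≤ 0) (≡.sym (Execution.wpos≡0 w t s≡)) z≤n
  where
  runs : ∀ w → Execution.HaltsWith w (reduce w)
  runs w with sepSplit w
  ... | no-sep ps          = run-no-sep w ps
  ... | at-sep u v pu refl = run-at-sep u v pu

proposition1 : (O : OpSet) → EF O ≤ₘˡᵒᵍ CSP O
proposition1 O = reduce , (reducer , reducer-computes) , λ x → ef⇒csp O x , csp⇒ef O x
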